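{- Let $\mathcal{S}_1=\langle S_1,\nu_1\rangle$ and $\mathcal{S}_2=\langle S_2,\nu_2\rangle$ be neighbourhood frames. A relation $R\subseteq S_1\times S_2$ is a $2^2$-bisimulation between $\mathcal{S}_1$ and $\mathcal{S}_2$ if and only if for all $(s_1,s_2)\in R$, all $U_1,U_1'\subseteq S_1$ and all $U_2,U_2'\subseteq S_2$: (1)(a) if $\mathrm{dom}(R)\cap U_1=\mathrm{dom}(R)\cap U_1'$ then $U_1\in\nu_1(s_1)$ iff $U_1'\in\nu_1(s_1)$; and (b) if $\mathrm{rng}(R)\cap U_2=\mathrm{rng}(R)\cap U_2'$ then $U_2\in\nu_2(s_2)$ iff $U_2'\in\nu_2(s_2)$; (2) if the pair $(U_1,U_2)$ is $R$-coherent, then $U_1\in\nu_1(s_1)$ iff $U_2\in\nu_2(s_2)$.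
   Context: A neighbourhood frame is $\langle S,\nu\rangle$ with $\nu\colon S\to\mathcal{P}(\mathcal{P}(S))$. A function $f\colon S_1\to S_2$ is a bounded morphism $\langle S_1,\nu_1\rangle\to\langle S_2,\nu_2\rangle$ if for all $s\in S_1$ and $X\subseteq S_2$: $f^{ -1}[X]\in\nu_1(s)$ iff $X\in\nu_2(f(s))$. $R\subseteq S_1\times S_2$ is a $2^2$-bisimulation if there exists $\mu\colon R\to\mathcal{P}(\mathcal{P}(R))$ such that both projections $\pi_i\colon\langle R,\mu\rangle\to\langle S_i,\nu_i\rangle$ are bounded morphisms. $\mathrm{dom}(R)=\{x\mid\exists y\,(x,y)\in R\}$, $\mathrm{rng}(R)=\{y\mid\exists x\,(x,y)\in R\}$. A pair $(U_1,U_2)$ with $U_i\subseteq S_i$ is $R$-coherent if $R[U_1]\subseteq U_2$ and $R^{ -1}[U_2]\subseteq U_1$ (equivalently, for all $(x_1,x_2)\in R$: $x_1\in U_1$ iff $x_2\in U_2$). -}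

module Defs where

open import Level using (Level; suc)
open import Data.Product using (Σ; _×_; _,_; proj₁; proj₂; ∃)
open import Function.Bundles using (_⇔_)
open import Relation.Unary using (Pred; _≐_; _⊆_; _∩_)

-- Since Agda
-- predicates are not extensional, the powerset P(P(S)) is rendered as
-- families of predicates closed under pointwise equality (≐), i.e.
-- neighbourhoods are genuinely sets of *sets*.
record NbhdFrame (ℓ : Level) : Set (suc (suc ℓ)) where
  field
    S     : Set ℓ
    ν     : S → Pred S ℓ → Set (suc ℓ)
    ν-ext : ∀ s {X Y : Pred S ℓ} → X ≐ Y → ν s X → ν s Y
open NbhdFrame public

preimage : ∀ {ℓ} {A B : Set ℓ} → (A → B) → Pred B ℓ → Pred A ℓ
preimage f X a = X (f a)

IsBoundedMorphism : ∀ {ℓ} (F G : NbhdFrame ℓ) → (S F → S G) → Set (suc ℓ)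
IsBoundedMorphism F G f =
  ∀ (s : S F) (X : Pred (S G) _) → ν F s (preimage f X) ⇔ ν G (f s) X

Rel : ∀ {ℓ} → Set ℓ → Set ℓ → Set (suc ℓ)
Rel {ℓ} A B = A → B → Set ℓ

∣_∣ : ∀ {ℓ} {A B : Set ℓ} → Rel A B → Set ℓ
∣_∣ {A = A} {B} R = Σ (A × B) (λ p → R (proj₁ p) (proj₂ p))

π₁ : ∀ {ℓ} {A B : Set ℓ} {R : Rel A B} → ∣ R ∣ → A
π₁ ((a , _) , _) = a

π₂ : ∀ {ℓ} {A B : Set ℓ} {R : Rel A B} → ∣ R ∣ → B
π₂ ((_ , b) , _) = b

Is2²Bisimulation : ∀ {ℓ} (F G : NbhdFrame ℓ) → Rel (S F) (S G) → Set (suc (suc ℓ))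
Is2²Bisimulation {ℓ} F G R =
  Σ (∣ R ∣ → Pred ∣ R ∣ ℓ → Set (suc ℓ)) λ μ →
  Σ (∀ r {X Y : Pred ∣ R ∣ ℓ} → X ≐ Y → μ r X → μ r Y) λ μ-ext →
    let RF = record { S = ∣ R ∣ ; ν = μ ; ν-ext = μ-ext } in
    IsBoundedMorphism RF F (π₁ {R = R}) × IsBoundedMorphism RF G (π₂ {R = R})

dom : ∀ {ℓ} {A B : Set ℓ} → Rel A B → Pred A ℓ
dom R x = ∃ λ y → R x y

rng : ∀ {ℓ} {A B : Set ℓ} → Rel A B → Pred B ℓ
rng R y = ∃ λ x → R x y

image : ∀ {ℓ} {A B : Set ℓ} → Rel A B → Pred A ℓ → Pred B ℓ
image R U y = ∃ λ x → R x y × U x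

preimageRel : ∀ {ℓ} {A B : Set ℓ} → Rel A B → Pred B ℓ → Pred A ℓ
preimageRel R V x = ∃ λ y → R x y × V y

Coherent : ∀ {ℓ} {A B : Set ℓ} → Rel A B → Pred A ℓ → Pred B ℓ → Set ℓ
Coherent R U₁ U₂ = (image R U₁ ⊆ U₂) × (preimageRel R U₂ ⊆ U₁)

module Submission where

-- The proof lives on the carrier ∣ R ∣ with its projections π₁, π₂.
-- The three conditions are exactly statements about preimages:
--   dom R ∩ U ≐ dom R ∩ U′   iff  π₁⁻¹[U] ≐ π₁⁻¹[U′],
--   rng R ∩ V ≐ rng R ∩ V′   iff  π₂⁻¹[V] ≐ π₂⁻¹[V′],
--   (U, V) R-coherent        iff  π₁⁻¹[U] ≐ π₂⁻¹[V].
-- (⇒) Two bounded morphisms out of one frame transport neighbourhoods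
--     between sets with equal preimages; apply this to (π₁,π₁), (π₂,π₂)
--     and (π₁,π₂).
-- (⇐) On any span  F ← E → G  take the "joint" neighbourhoods of r :
--     preimages of neighbourhoods of either image of r.  Both legs are
--     bounded morphisms once neighbourhoods are closed under replacing a
--     set by one with the same preimage; for the projections of R that
--     closure is precisely conditions (1) and (2).

open import Defs
open import Level using (Level)
open import Data.Product using (_×_; _,_; proj₁; proj₂; Σ)
open import Data.Sum using (_⊎_; inj₁; inj₂)
open import Function.Bundles using (_⇔_; mk⇔; Equivalence)
import Function.Properties.Equivalence as ⇔
open import Relation.Unary using (Pred; _≐_; _∩_)
open import Relation.Unary.Properties using (≐-sym; ≐-trans; ≐-refl)

ν-resp-≐ : ∀ {ℓ} (F : NbhdFrame ℓ) s {X Y : Pred (S F) ℓ} → X ≐ Y → ν F s X ⇔ ν F s Y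
ν-resp-≐ F s X≐Y = mk⇔ (ν-ext F s X≐Y) (ν-ext F s (≐-sym X≐Y))

transport : ∀ {ℓ} (E F G : NbhdFrame ℓ) {f : S E → S F} {g : S E → S G} →
  IsBoundedMorphism E F f → IsBoundedMorphism E G g →
  ∀ r {X Y} → preimage f X ≐ preimage g Y → ν F (f r) X ⇔ ν G (g r) Y
transport E F G f-bm g-bm r {X} {Y} eq =
  ⇔.trans (⇔.sym (f-bm r X)) (⇔.trans (ν-resp-≐ E r eq) (g-bm r Y))

module Joint {ℓ} {E : Set ℓ} (F G : NbhdFrame ℓ) (f : E → S F) (g : E → S G) where

  μ : E → Pred E ℓ → Set _
  μ r X = (Σ (Pred (S F) ℓ) λ U → preimage f U ≐ X × ν F (f r) U)
        ⊎ (Σ (Pred (S G) ℓ) λ V → preimage g V ≐ X × ν G (g r) V)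

  μ-ext : ∀ r {X Y : Pred E ℓ} → X ≐ Y → μ r X → μ r Y
  μ-ext r X≐Y (inj₁ (U , eq , n)) = inj₁ (U , ≐-trans eq X≐Y , n)
  μ-ext r X≐Y (inj₂ (V , eq , n)) = inj₂ (V , ≐-trans eq X≐Y , n)

  frame : NbhdFrame ℓ
  frame = record { S = E ; ν = μ ; ν-ext = μ-ext }

  left-bounded :
    (∀ r {U X} → preimage f U ≐ preimage f X → ν F (f r) U → ν F (f r) X) →
    (∀ r {V X} → preimage g V ≐ preimage f X → ν G (g r) V → ν F (f r) X) →
    IsBoundedMorphism frame F f
  left-bounded same cross r X = mk⇔ to (λ n → inj₁ (X , ≐-refl , n))
    where
    to : μ r (preimage f X) → ν F (f r) X
    to (inj₁ (U , eq , n)) = same r eq n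
    to (inj₂ (V , eq , n)) = cross r eq n

  right-bounded :
    (∀ r {V Y} → preimage g V ≐ preimage g Y → ν G (g r) V → ν G (g r) Y) →
    (∀ r {U Y} → preimage f U ≐ preimage g Y → ν F (f r) U → ν G (g r) Y) →
    IsBoundedMorphism frame G g
  right-bounded same cross r Y = mk⇔ to (λ n → inj₂ (Y , ≐-refl , n))
    where
    to : μ r (preimage g Y) → ν G (g r) Y
    to (inj₁ (U , eq , n)) = cross r eq n
    to (inj₂ (V , eq , n)) = same r eq n

module Projections {ℓ} {A B : Set ℓ} (R : Rel A B) where

  p₁ : ∣ R ∣ → A
  p₁ = π₁ {R = R}

  p₂ : ∣ R ∣ → B
  p₂ = π₂ {R = R}

  dom-agree⇔ : ∀ {U U′ : Pred A ℓ} →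
    (dom R ∩ U) ≐ (dom R ∩ U′) ⇔ preimage p₁ U ≐ preimage p₁ U′
  dom-agree⇔ = mk⇔
    (λ h → (λ { {(_ , b) , q} u → proj₂ (proj₁ h ((b , q) , u)) })
         , (λ { {(_ , b) , q} u → proj₂ (proj₂ h ((b , q) , u)) }))
    (λ e → (λ { {a} ((b , q) , u) → (b , q) , proj₁ e {(a , b) , q} u })
         , (λ { {a} ((b , q) , u) → (b , q) , proj₂ e {(a , b) , q} u }))

  rng-agree⇔ : ∀ {V V′ : Pred B ℓ} →
    (rng R ∩ V) ≐ (rng R ∩ V′) ⇔ preimage p₂ V ≐ preimage p₂ V′
  rng-agree⇔ = mk⇔
    (λ h → (λ { {(a , _) , q} v → proj₂ (proj₁ h ((a , q) , v)) })
         , (λ { {(a , _) , q} v → proj₂ (proj₂ h ((a , q) , v)) }))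
    (λ e → (λ { {b} ((a , q) , v) → (a , q) , proj₁ e {(a , b) , q} v })
         , (λ { {b} ((a , q) , v) → (a , q) , proj₂ e {(a , b) , q} v }))

  coherent⇔ : ∀ {U : Pred A ℓ} {V : Pred B ℓ} →
    Coherent R U V ⇔ preimage p₁ U ≐ preimage p₂ V
  coherent⇔ = mk⇔
    (λ { (R[U]⊆V , R⁻¹[V]⊆U) →
           (λ { {(a , _) , q} u → R[U]⊆V (a , q , u) })
         , (λ { {(_ , b) , q} v → R⁻¹[V]⊆U (b , q , v) }) })
    (λ e → (λ { {b} (a , q , u) → proj₁ e {(a , b) , q} u })
         , (λ { {a} (b , q , v) → proj₂ e {(a , b) , q} v }))

module _ {ℓ : Level} (F G : NbhdFrame ℓ) (R : Rel (S F) (S G)) where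
  open Projections R

  LocalConditions : Set _
  LocalConditions = ∀ (s₁ : S F) (s₂ : S G) → R s₁ s₂ →
    ∀ (U₁ U₁′ : Pred (S F) ℓ) (U₂ U₂′ : Pred (S G) ℓ) →
      (((dom R ∩ U₁) ≐ (dom R ∩ U₁′) → (ν F s₁ U₁ ⇔ ν F s₁ U₁′))
      × ((rng R ∩ U₂) ≐ (rng R ∩ U₂′) → (ν G s₂ U₂ ⇔ ν G s₂ U₂′)))
      × (Coherent R U₁ U₂ → (ν F s₁ U₁ ⇔ ν G s₂ U₂))

  bisimulation⇒conditions : Is2²Bisimulation F G R → LocalConditions
  bisimulation⇒conditions (μ , μ-ext , p₁-bm , p₂-bm) s₁ s₂ q _ _ _ _ =
      ( (λ h → transport apex F F p₁-bm p₁-bm r (Equivalence.to dom-agree⇔ h))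
      , (λ h → transport apex G G p₂-bm p₂-bm r (Equivalence.to rng-agree⇔ h)) )
    , (λ c → transport apex F G p₁-bm p₂-bm r (Equivalence.to coherent⇔ c))
    where
    apex : NbhdFrame ℓ
    apex = record { S = ∣ R ∣ ; ν = μ ; ν-ext = μ-ext }
    r : ∣ R ∣
    r = (s₁ , s₂) , q

  -- Where only one side of condition (1) is needed, the other side's sets
  -- are irrelevant and filled with the full set.
  conditions⇒bisimulation : LocalConditions → Is2²Bisimulation F G R
  conditions⇒bisimulation H = μ , μ-ext , left-bounded same₁ cross₁ , right-bounded same₂ cross₂
    where
    open Joint F G p₁ p₂
    same₁ : ∀ r {U X} → preimage p₁ U ≐ preimage p₁ X → ν F (p₁ r) U → ν F (p₁ r) X
    same₁ ((s₁ , s₂) , q) {U} {X} e =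
      Equivalence.to (proj₁ (proj₁ (H s₁ s₂ q U X X⊤ X⊤)) (Equivalence.from dom-agree⇔ e))
      where X⊤ = λ (_ : S G) → S G
    cross₁ : ∀ r {V X} → preimage p₂ V ≐ preimage p₁ X → ν G (p₂ r) V → ν F (p₁ r) X
    cross₁ ((s₁ , s₂) , q) {V} {X} e =
      Equivalence.from (proj₂ (H s₁ s₂ q X X V V) (Equivalence.from coherent⇔ (≐-sym e)))
    same₂ : ∀ r {V Y} → preimage p₂ V ≐ preimage p₂ Y → ν G (p₂ r) V → ν G (p₂ r) Y
    same₂ ((s₁ , s₂) , q) {V} {Y} e =
      Equivalence.to (proj₂ (proj₁ (H s₁ s₂ q U⊤ U⊤ V Y)) (Equivalence.from rng-agree⇔ e))
      where U⊤ = λ (_ : S F) → S F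
    cross₂ : ∀ r {U Y} → preimage p₁ U ≐ preimage p₂ Y → ν F (p₁ r) U → ν G (p₂ r) Y
    cross₂ ((s₁ , s₂) , q) {U} {Y} e =
      Equivalence.to (proj₂ (H s₁ s₂ q U U Y Y) (Equivalence.from coherent⇔ e))

proposition3p15 : ∀ {ℓ : Level} (F G : NbhdFrame ℓ) (R : Rel (S F) (S G)) →
    Is2²Bisimulation F G R ⇔
      (∀ (s₁ : S F) (s₂ : S G) → R s₁ s₂ →
        ∀ (U₁ U₁′ : Pred (S F) ℓ) (U₂ U₂′ : Pred (S G) ℓ) →
          (((dom R ∩ U₁) ≐ (dom R ∩ U₁′) → (ν F s₁ U₁ ⇔ ν F s₁ U₁′))
          × ((rng R ∩ U₂) ≐ (rng R ∩ U₂′) → (ν G s₂ U₂ ⇔ ν G s₂ U₂′)))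
          × (Coherent R U₁ U₂ → (ν F s₁ U₁ ⇔ ν G s₂ U₂)))
proposition3p15 F G R =
  mk⇔ (bisimulation⇒conditions F G R) (conditions⇒bisimulation F G R)
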